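{- Let $m<n$, let $\pi_1$ be a permutation of $[m]$ and $\pi_2$ a permutation of $\{m+1,\dotsc,n\}$, let $\mu\in(\mathbb{Z}_{\ge0})^n$ and let $\hat\sigma\in\mathrm{NAF}_\mu^{\pi_1\pi_2}$. Let $L$ be the number of boxes $u\in\mathrm{dg}'(\mu)$ with $f(\hat\sigma)(u)\in\{m+1,\dotsc,n\}$, and let $p=\sum_{i=m+1}^n\mu_i$. Then $$\mathrm{maj}(f(\hat\sigma))=\mathrm{maj}'(\hat\sigma)-p+L.$$
   Context: $\pi_1\pi_2\in S_n$ is the concatenation ($i\mapsto\pi_1(i)$ for $i\le m$, $i\mapsto\pi_2(i)$ for $i>m$). For a permutation $\rho$ of $[a,b]$, $\rho^c(i)=a+b-\rho(i)$. For $\mu\in(\mathbb{Z}_{\ge0})^n$: $\mathrm{dg}'(\mu)=\{(i,j):1\le i\le n,\ 1\le j\le\mu_i\}$, $\hat{\mathrm{dg}}(\mu)=\mathrm{dg}'(\mu)\cup\{(i,0):1\le i\le n\}$; for $u=(i,j)\in\mathrm{dg}'(\mu)$, $d(u)=(i,j-1)$ and $l(u)=\mu_i-j$. An augmented filling with basement $\pi\in S_n$ is $\hat\sigma:\hat{\mathrm{dg}}(\mu)\to[n]$ with $\hat\sigma(i,0)=\pi(i)$. Distinct boxes attack if in the same row or of the form $(i,j),(i',j-1)$ with $i'>i$; $\mathrm{NAF}^\pi_\mu$ is the set of augmented fillings with basement $\pi$ with distinct values on attacking pairs. A box $u\in\mathrm{dg}'(\mu)$ is a descent if $\hat\sigma(u)>\hat\sigma(d(u))$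 and an ascent if $\hat\sigma(u)<\hat\sigma(d(u))$; $\mathrm{maj}(\hat\sigma)=\sum_{u\text{ descent}}(l(u)+1)$ and $\mathrm{maj}'(\hat\sigma)=\sum_{u\text{ ascent}}(l(u)+1)$. The map $f:\mathrm{NAF}_\mu^{\pi_1\pi_2}\to\mathrm{NAF}_\mu^{\pi_1^c\pi_2^c}$: $f(\hat\sigma)$ has basement $\pi_1^c\pi_2^c$ and, for $u\in\mathrm{dg}'(\mu)$, $f(\hat\sigma)(u)=\pi_1^c\pi_1^{ -1}(\hat\sigma(u))=m+1-\hat\sigma(u)$ if $\hat\sigma(u)\le m$, and $f(\hat\sigma)(u)=\pi_2^c\pi_2^{ -1}(\hat\sigma(u))=n+m+1-\hat\sigma(u)$ if $\hat\sigma(u)\ge m+1$. -}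

module Defs where

open import Data.Nat using (ℕ; zero; suc; _+_; _∸_; _≤_; _<_; _≤?_; _<?_)
open import Data.Bool using (Bool; true; false; if_then_else_)
open import Data.List using (List; map; upTo)
open import Data.Nat.ListAction using (sum)
open import Data.Product using (_×_; Σ; ∃; ∃-syntax)
open import Relation.Nullary using (¬_)
open import Relation.Nullary.Decidable using (⌊_⌋)
open import Relation.Binary.PropositionalEquality using (_≡_)

-- Conventions: all indices and values are natural numbers, 1-based as in
-- the paper.  A composition μ ∈ ℕ^n is a function ℕ → ℕ of which only
-- μ 1 , … , μ n matter.  A cell (i , j) of the diagram: i = column index
-- (1 ≤ i ≤ n), j = height (0 = basement).  A filling is a function
-- ℕ → ℕ → ℕ, σ i j = value in cell (i , j); only values on the diagram matter.

Filling : Set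
Filling = ℕ → ℕ → ℕ

range : ℕ → ℕ → List ℕ
range a b = map (a +_) (upTo (suc b ∸ a))

sumRange : ℕ → ℕ → (ℕ → ℕ) → ℕ
sumRange a b f = sum (map f (range a b))

IsPermOf : ℕ → ℕ → (ℕ → ℕ) → Set
IsPermOf a b ρ =
  (∀ i → a ≤ i → i ≤ b → (a ≤ ρ i) × (ρ i ≤ b)) ×
  (∀ i i' → a ≤ i → i ≤ b → a ≤ i' → i' ≤ b → ρ i ≡ ρ i' → i ≡ i') ×
  (∀ k → a ≤ k → k ≤ b → ∃[ i ] ((a ≤ i) × (i ≤ b) × (ρ i ≡ k)))

concatPerm : ℕ → (ℕ → ℕ) → (ℕ → ℕ) → (ℕ → ℕ)
concatPerm m π₁ π₂ i = if ⌊ i ≤? m ⌋ then π₁ i else π₂ i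

compl : ℕ → ℕ → (ℕ → ℕ) → (ℕ → ℕ)
compl a b ρ i = (a + b) ∸ ρ i

InDgHat : ℕ → (ℕ → ℕ) → ℕ → ℕ → Set
InDgHat n μ i j = (1 ≤ i) × (i ≤ n) × (j ≤ μ i)

IsAugFilling : ℕ → (ℕ → ℕ) → (ℕ → ℕ) → Filling → Set
IsAugFilling n μ π σ =
  (∀ i j → InDgHat n μ i j → (1 ≤ σ i j) × (σ i j ≤ n)) ×
  (∀ i → 1 ≤ i → i ≤ n → σ i 0 ≡ π i)

NonAttacking : ℕ → (ℕ → ℕ) → Filling → Set
NonAttacking n μ σ =
  (∀ i i' j → InDgHat n μ i j → InDgHat n μ i' j → ¬ (i ≡ i') → ¬ (σ i j ≡ σ i' j)) ×
  (∀ i i' j → InDgHat n μ i (suc j) → InDgHat n μ i' j → i < i' → ¬ (σ i (suc j) ≡ σ i' j))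

NAF : ℕ → (ℕ → ℕ) → (ℕ → ℕ) → Filling → Set
NAF n μ π σ = IsAugFilling n μ π σ × NonAttacking n μ σ

leg : (ℕ → ℕ) → ℕ → ℕ → ℕ
leg μ i j = μ i ∸ j

maj : ℕ → (ℕ → ℕ) → Filling → ℕ
maj n μ σ = sumRange 1 n λ i → sumRange 1 (μ i) λ j →
  if ⌊ σ i (j ∸ 1) <? σ i j ⌋ then leg μ i j + 1 else 0

maj' : ℕ → (ℕ → ℕ) → Filling → ℕ
maj' n μ σ = sumRange 1 n λ i → sumRange 1 (μ i) λ j →
  if ⌊ σ i j <? σ i (j ∸ 1) ⌋ then leg μ i j + 1 else 0

fMap : ℕ → ℕ → (ℕ → ℕ) → (ℕ → ℕ) → Filling → Filling
fMap m n π₁ π₂ σ i zero = concatPerm m (compl 1 m π₁) (compl (suc m) n π₂) i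
fMap m n π₁ π₂ σ i (suc j) =
  if ⌊ σ i (suc j) ≤? m ⌋ then (m + 1) ∸ σ i (suc j) else (n + m + 1) ∸ σ i (suc j)

countBig : ℕ → ℕ → (ℕ → ℕ) → Filling → ℕ
countBig m n μ τ = sumRange 1 n λ i → sumRange 1 (μ i) λ j →
  if ⌊ m <? τ i j ⌋ then (if ⌊ τ i j ≤? n ⌋ then 1 else 0) else 0

-- Along a column, f reverses the order on [1,m] and on [m+1,n], keeps each block, and puts
-- [1,m] below [m+1,n]. So, writing B v = [m < v], the descent indicator of f(σ) at a box u is
-- the ascent indicator of σ at u plus B (f(σ)(u)) − B (f(σ)(d(u))). Weighted by l(u) + 1 these
-- corrections telescope along column i to the number of its boxes with B = 1 minus μ_i times
-- B of its basement, and that basement lies in [m+1,n] exactly when i > m, which gives p.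
module Submission where

open import Defs
open import Data.Nat using (ℕ; suc; _<_; _≤_)
open import Relation.Binary.PropositionalEquality using (_≡_)

module FiniteSums where
  open import Data.Nat using (zero; _+_; _*_; _∸_; z≤n; s≤s)
  open import Data.Nat.Properties
  open import Data.Nat.ListAction using (sum)
  open import Data.Nat.Tactic.RingSolver using (solve-∀)
  open import Data.List using (map; applyUpTo)
  open import Relation.Binary.PropositionalEquality
    using (refl; sym; trans; cong; cong₂; subst; module ≡-Reasoning)

  sumFrom : (ℕ → ℕ) → ℕ → ℕ → ℕ
  sumFrom f a zero    = 0
  sumFrom f a (suc k) = f a + sumFrom f (suc a) k

  sum-map-applyUpTo : ∀ f h a k (g : ℕ → ℕ) → (∀ j → h (g j) ≡ a + j) →
    sum (map f (map h (applyUpTo g k))) ≡ sumFrom f a k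
  sum-map-applyUpTo f h a zero    g hg≡a+ = refl
  sum-map-applyUpTo f h a (suc k) g hg≡a+ =
    cong₂ _+_ (cong f (trans (hg≡a+ 0) (+-identityʳ a)))
      (sum-map-applyUpTo f h (suc a) k (λ j → g (suc j))
        (λ j → trans (hg≡a+ (suc j)) (+-suc a j)))

  sumRange≡sumFrom : ∀ a b f → sumRange a b f ≡ sumFrom f a (suc b ∸ a)
  sumRange≡sumFrom a b f = sum-map-applyUpTo f (a +_) a (suc b ∸ a) (λ j → j) (λ _ → refl)

  sumFrom-0 : ∀ a k → sumFrom (λ _ → 0) a k ≡ 0
  sumFrom-0 a zero    = refl
  sumFrom-0 a (suc k) = sumFrom-0 (suc a) k

  sumFrom-cong : ∀ {f g} a k → (∀ i → a ≤ i → i < a + k → f i ≡ g i) →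
    sumFrom f a k ≡ sumFrom g a k
  sumFrom-cong a zero    f≗g = refl
  sumFrom-cong a (suc k) f≗g =
    cong₂ _+_ (f≗g a ≤-refl (subst (a <_) (sym (+-suc a k)) (s≤s (m≤m+n a k))))
      (sumFrom-cong (suc a) k λ i a<i i<1+a+k →
        f≗g i (<⇒≤ a<i) (subst (i <_) (sym (+-suc a k)) i<1+a+k))

  sumRange-nested≡sumFrom : ∀ N (c : ℕ → ℕ) (F : ℕ → ℕ → ℕ) →
    sumRange 1 N (λ i → sumRange 1 (c i) (F i)) ≡ sumFrom (λ i → sumFrom (F i) 1 (c i)) 1 N
  sumRange-nested≡sumFrom N c F =
    trans (sumRange≡sumFrom 1 N _) (sumFrom-cong 1 N λ i _ _ → sumRange≡sumFrom 1 (c i) (F i))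

  sumFrom-+ : ∀ f g a k → sumFrom (λ i → f i + g i) a k ≡ sumFrom f a k + sumFrom g a k
  sumFrom-+ f g a zero    = refl
  sumFrom-+ f g a (suc k) =
    trans (cong (f a + g a +_) (sumFrom-+ f g (suc a) k))
      (+-exchange (f a) (g a) (sumFrom f (suc a) k) (sumFrom g (suc a) k))
    where
    +-exchange : ∀ w x y z → (w + x) + (y + z) ≡ (w + y) + (x + z)
    +-exchange = solve-∀

  sumFrom-++ : ∀ f a d k → sumFrom f a (d + k) ≡ sumFrom f a d + sumFrom f (a + d) k
  sumFrom-++ f a zero    k = cong (λ b → sumFrom f b k) (sym (+-identityʳ a))
  sumFrom-++ f a (suc d) k = begin
    f a + sumFrom f (suc a) (d + k)
      ≡⟨ cong (f a +_) (sumFrom-++ f (suc a) d k) ⟩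
    f a + (sumFrom f (suc a) d + sumFrom f (suc (a + d)) k)
      ≡⟨ sym (+-assoc (f a) _ _) ⟩
    (f a + sumFrom f (suc a) d) + sumFrom f (suc (a + d)) k
      ≡⟨ cong (λ b → f a + sumFrom f (suc a) d + sumFrom f b k) (sym (+-suc a d)) ⟩
    (f a + sumFrom f (suc a) d) + sumFrom f (a + suc d) k ∎
    where open ≡-Reasoning

  -- The weights N ∸ j + 1 are the l(u) + 1 of the boxes u = (i , j) of a column of height N.
  summation-by-parts : ∀ (D A b : ℕ → ℕ) N →
    (∀ j → 1 ≤ j → j ≤ N → D j + (N ∸ j + 1) * b (j ∸ 1) ≡ A j + (N ∸ j + 1) * b j) →
    sumFrom D 1 N + N * b 0 ≡ sumFrom A 1 N + sumFrom b 1 N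
  summation-by-parts D A b N step = from 0 N refl
    where
    open ≡-Reasoning

    weight : ∀ a k → a + suc k ≡ N → N ∸ suc a + 1 ≡ suc k
    weight a k a+1+k≡N = begin
      N ∸ suc a + 1           ≡⟨ cong (λ x → x ∸ suc a + 1) (sym a+1+k≡N) ⟩
      a + suc k ∸ suc a + 1   ≡⟨ cong (λ x → x ∸ suc a + 1) (+-suc a k) ⟩
      a + k ∸ a + 1           ≡⟨ cong (_+ 1) (m+n∸m≡n a k) ⟩
      k + 1                   ≡⟨ +-comm k 1 ⟩
      suc k                   ∎

    from : ∀ a k → a + k ≡ N →
      sumFrom D (suc a) k + k * b a ≡ sumFrom A (suc a) k + sumFrom b (suc a) k
    from a zero    _         = refl
    from a (suc k) a+1+k≡N = begin
      (D₁ + ΣD) + suc k * b a     ≡⟨ rearrange₁ D₁ ΣD (suc k * b a) ⟩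
      (D₁ + suc k * b a) + ΣD     ≡⟨ cong (_+ ΣD) first ⟩
      (A₁ + suc k * b₁) + ΣD      ≡⟨ rearrange₂ A₁ k b₁ ΣD ⟩
      (A₁ + b₁) + (ΣD + k * b₁)   ≡⟨ cong ((A₁ + b₁) +_) rest ⟩
      (A₁ + b₁) + (ΣA + Σb)       ≡⟨ rearrange₃ A₁ b₁ ΣA Σb ⟩
      (A₁ + ΣA) + (b₁ + Σb)       ∎
      where
      D₁ = D (suc a)
      A₁ = A (suc a)
      b₁ = b (suc a)
      ΣD = sumFrom D (suc (suc a)) k
      ΣA = sumFrom A (suc (suc a)) k
      Σb = sumFrom b (suc (suc a)) k

      first : D₁ + suc k * b a ≡ A₁ + suc k * b₁
      first = subst (λ w → D₁ + w * b a ≡ A₁ + w * b₁) (weight a k a+1+k≡N)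
        (step (suc a) (s≤s z≤n)
          (subst (suc a ≤_) (trans (sym (+-suc a k)) a+1+k≡N) (s≤s (m≤m+n a k))))

      rest : ΣD + k * b₁ ≡ ΣA + Σb
      rest = from (suc a) k (trans (sym (+-suc a k)) a+1+k≡N)

      rearrange₁ : ∀ x y z → (x + y) + z ≡ (x + z) + y
      rearrange₁ = solve-∀
      rearrange₂ : ∀ x k y z → (x + suc k * y) + z ≡ (x + y) + (z + k * y)
      rearrange₂ = solve-∀
      rearrange₃ : ∀ w x y z → (w + x) + (y + z) ≡ (w + y) + (x + z)
      rearrange₃ = solve-∀

module Indicators where
  open import Data.Nat using (_*_; _∸_; _<?_)
  open import Data.Nat.Properties using (*-identityʳ; *-zeroʳ; ∸-monoʳ-<; ∸-monoʳ-≤; ≤⇒≯; ≮⇒≥)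
  open import Data.Bool using (Bool; true; false; if_then_else_)
  open import Data.Empty using (⊥-elim)
  open import Relation.Nullary using (¬_; Dec; yes; no)
  open import Relation.Nullary.Decidable using (⌊_⌋)
  open import Relation.Binary.PropositionalEquality using (refl; sym)

  𝟙 : Bool → ℕ
  𝟙 true  = 1
  𝟙 false = 0

  if-then-0 : ∀ b w → (if b then w else 0) ≡ w * 𝟙 b
  if-then-0 true  w = sym (*-identityʳ w)
  if-then-0 false w = sym (*-zeroʳ w)

  ⌊⌋-true : ∀ {A : Set} (a? : Dec A) → A → ⌊ a? ⌋ ≡ true
  ⌊⌋-true (yes _) _ = refl
  ⌊⌋-true (no ¬a) a = ⊥-elim (¬a a)

  ⌊⌋-false : ∀ {A : Set} (a? : Dec A) → ¬ A → ⌊ a? ⌋ ≡ false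
  ⌊⌋-false (no _)  _  = refl
  ⌊⌋-false (yes a) ¬a = ⊥-elim (¬a a)

  ∸-<?-flip : ∀ c x y → x ≤ c → y ≤ c → ⌊ c ∸ x <? c ∸ y ⌋ ≡ ⌊ y <? x ⌋
  ∸-<?-flip c x y x≤c y≤c with y <? x
  ... | yes y<x = ⌊⌋-true (c ∸ x <? c ∸ y) (∸-monoʳ-< y<x x≤c)
  ... | no  y≮x = ⌊⌋-false (c ∸ x <? c ∸ y) (≤⇒≯ (∸-monoʳ-≤ c (≮⇒≥ y≮x)))

module ComplementMap (m n : ℕ) where
  open import Data.Nat using (_+_; _*_; _∸_; _≤?_; _<?_)
  open import Data.Nat.Properties
  open import Data.Bool using (if_then_else_)
  open import Data.Product using (_×_; proj₁; proj₂)
  open import Relation.Nullary using (Dec; yes; no)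
  open import Relation.Nullary.Decidable using (⌊_⌋)
  open import Relation.Binary.PropositionalEquality
    using (refl; sym; trans; cong; subst; module ≡-Reasoning)
  open FiniteSums
  open Indicators

  fValue : ℕ → ℕ
  fValue v = if ⌊ v ≤? m ⌋ then (m + 1) ∸ v else (n + m + 1) ∸ v

  big : ℕ → ℕ
  big v = if ⌊ m <? v ⌋ then (if ⌊ v ≤? n ⌋ then 1 else 0) else 0

  fValue-small : ∀ {v} → v ≤ m → fValue v ≡ (m + 1) ∸ v
  fValue-small {v} v≤m rewrite ⌊⌋-true (v ≤? m) v≤m = refl

  fValue-large : ∀ {v} → m < v → fValue v ≡ (n + m + 1) ∸ v
  fValue-large {v} m<v rewrite ⌊⌋-false (v ≤? m) (<⇒≱ m<v) = refl

  big-small : ∀ {v} → v ≤ m → big v ≡ 0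
  big-small {v} v≤m rewrite ⌊⌋-false (m <? v) (≤⇒≯ v≤m) = refl

  big-large : ∀ {v} → m < v → v ≤ n → big v ≡ 1
  big-large {v} m<v v≤n rewrite ⌊⌋-true (m <? v) m<v | ⌊⌋-true (v ≤? n) v≤n = refl

  fValue-small≤m : ∀ {v} → 1 ≤ v → v ≤ m → fValue v ≤ m
  fValue-small≤m {v} 1≤v v≤m rewrite fValue-small v≤m =
    subst (m + 1 ∸ v ≤_) (m+n∸n≡m m 1) (∸-monoʳ-≤ (m + 1) 1≤v)

  m<fValue-large : ∀ {v} → m < v → v ≤ n → m < fValue v
  m<fValue-large {v} m<v v≤n rewrite fValue-large m<v =
    subst (_≤ n + m + 1 ∸ v) n+m+1∸n≡1+m (∸-monoʳ-≤ (n + m + 1) v≤n)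
    where
    n+m+1∸n≡1+m : n + m + 1 ∸ n ≡ suc m
    n+m+1∸n≡1+m = trans (cong (_∸ n) (+-assoc n m 1)) (trans (m+n∸m≡n n (m + 1)) (+-comm m 1))

  fValue-large≤n : ∀ {v} → m < v → fValue v ≤ n
  fValue-large≤n {v} m<v rewrite fValue-large m<v =
    subst (n + m + 1 ∸ v ≤_) n+m+1∸[m+1]≡n (∸-monoʳ-≤ (n + m + 1) (subst (_≤ v) (+-comm 1 m) m<v))
    where
    n+m+1∸[m+1]≡n : n + m + 1 ∸ (m + 1) ≡ n
    n+m+1∸[m+1]≡n = trans (cong (_∸ (m + 1)) (+-assoc n m 1)) (m+n∸n≡m n (m + 1))

  big-fValue-small : ∀ {v} → 1 ≤ v → v ≤ m → big (fValue v) ≡ 0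
  big-fValue-small 1≤v v≤m = big-small (fValue-small≤m 1≤v v≤m)

  big-fValue-large : ∀ {v} → m < v → v ≤ n → big (fValue v) ≡ 1
  big-fValue-large m<v v≤n = big-large (m<fValue-large m<v v≤n) (fValue-large≤n m<v)

  descent-balance : ∀ {x y} → 1 ≤ x → x ≤ n → 1 ≤ y → y ≤ n →
    𝟙 ⌊ fValue x <? fValue y ⌋ + big (fValue x) ≡ 𝟙 ⌊ y <? x ⌋ + big (fValue y)
  descent-balance {x} {y} 1≤x x≤n 1≤y y≤n = by-blocks (x ≤? m) (y ≤? m)
    where
    ≤n+m+1 : ∀ {v} → v ≤ n → v ≤ n + m + 1
    ≤n+m+1 v≤n = ≤-trans v≤n (≤-trans (m≤m+n n m) (m≤m+n (n + m) 1))

    by-blocks : Dec (x ≤ m) → Dec (y ≤ m) →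
      𝟙 ⌊ fValue x <? fValue y ⌋ + big (fValue x) ≡ 𝟙 ⌊ y <? x ⌋ + big (fValue y)
    by-blocks (yes x≤m) (yes y≤m)
      rewrite big-fValue-small 1≤x x≤m | big-fValue-small 1≤y y≤m
            | fValue-small x≤m | fValue-small y≤m
            | ∸-<?-flip (m + 1) x y (≤-trans x≤m (m≤m+n m 1)) (≤-trans y≤m (m≤m+n m 1)) = refl
    by-blocks (no x≰m) (no y≰m)
      rewrite big-fValue-large (≰⇒> x≰m) x≤n | big-fValue-large (≰⇒> y≰m) y≤n
            | fValue-large (≰⇒> x≰m) | fValue-large (≰⇒> y≰m)
            | ∸-<?-flip (n + m + 1) x y (≤n+m+1 x≤n) (≤n+m+1 y≤n) = refl
    by-blocks (yes x≤m) (no y≰m)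
      rewrite ⌊⌋-true (fValue x <? fValue y)
                (≤-<-trans (fValue-small≤m 1≤x x≤m) (m<fValue-large (≰⇒> y≰m) y≤n))
            | ⌊⌋-false (y <? x) (≤⇒≯ (≤-trans x≤m (<⇒≤ (≰⇒> y≰m))))
            | big-fValue-small 1≤x x≤m | big-fValue-large (≰⇒> y≰m) y≤n = refl
    by-blocks (no x≰m) (yes y≤m)
      rewrite ⌊⌋-false (fValue x <? fValue y)
                (≤⇒≯ (≤-trans (fValue-small≤m 1≤y y≤m) (<⇒≤ (m<fValue-large (≰⇒> x≰m) x≤n))))
            | ⌊⌋-true (y <? x) (≤-<-trans y≤m (≰⇒> x≰m))
            | big-fValue-large (≰⇒> x≰m) x≤n | big-fValue-small 1≤y y≤m = refl

  weighted-step : ∀ {x y} → 1 ≤ x → x ≤ n → 1 ≤ y → y ≤ n → ∀ w →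
    (if ⌊ fValue x <? fValue y ⌋ then w else 0) + w * big (fValue x)
      ≡ (if ⌊ y <? x ⌋ then w else 0) + w * big (fValue y)
  weighted-step {x} {y} 1≤x x≤n 1≤y y≤n w = begin
    (if ⌊ fValue x <? fValue y ⌋ then w else 0) + w * big (fValue x)
      ≡⟨ cong (_+ w * big (fValue x)) (if-then-0 ⌊ fValue x <? fValue y ⌋ w) ⟩
    w * 𝟙 ⌊ fValue x <? fValue y ⌋ + w * big (fValue x)
      ≡⟨ sym (*-distribˡ-+ w _ _) ⟩
    w * (𝟙 ⌊ fValue x <? fValue y ⌋ + big (fValue x))
      ≡⟨ cong (w *_) (descent-balance 1≤x x≤n 1≤y y≤n) ⟩
    w * (𝟙 ⌊ y <? x ⌋ + big (fValue y))
      ≡⟨ *-distribˡ-+ w _ _ ⟩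
    w * 𝟙 ⌊ y <? x ⌋ + w * big (fValue y)
      ≡⟨ cong (_+ w * big (fValue y)) (sym (if-then-0 ⌊ y <? x ⌋ w)) ⟩
    (if ⌊ y <? x ⌋ then w else 0) + w * big (fValue y) ∎
    where open ≡-Reasoning

  descentWeight ascentWeight : ℕ → (ℕ → ℕ) → ℕ → ℕ
  descentWeight N t j = if ⌊ t (j ∸ 1) <? t j ⌋ then N ∸ j + 1 else 0
  ascentWeight  N s j = if ⌊ s j <? s (j ∸ 1) ⌋ then N ∸ j + 1 else 0

  column-balance : ∀ N (s t : ℕ → ℕ) →
    (∀ j → j ≤ N → 1 ≤ s j × s j ≤ n) → (∀ j → j ≤ N → t j ≡ fValue (s j)) →
    sumFrom (descentWeight N t) 1 N + N * big (t 0)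
      ≡ sumFrom (ascentWeight N s) 1 N + sumFrom (λ j → big (t j)) 1 N
  column-balance N s t s∈[1,n] t≡fs =
    summation-by-parts (descentWeight N t) (ascentWeight N s) (λ j → big (t j)) N step
    where
    step : ∀ j → 1 ≤ j → j ≤ N →
      descentWeight N t j + (N ∸ j + 1) * big (t (j ∸ 1))
        ≡ ascentWeight N s j + (N ∸ j + 1) * big (t j)
    step (suc a) _ 1+a≤N
      rewrite t≡fs a (<⇒≤ 1+a≤N) | t≡fs (suc a) 1+a≤N =
      weighted-step (proj₁ (s∈[1,n] a (<⇒≤ 1+a≤N))) (proj₂ (s∈[1,n] a (<⇒≤ 1+a≤N)))
        (proj₁ (s∈[1,n] (suc a) 1+a≤N)) (proj₂ (s∈[1,n] (suc a) 1+a≤N)) (N ∸ suc a + 1)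

  concatPerm-small : ∀ (f g : ℕ → ℕ) {i} → i ≤ m → concatPerm m f g i ≡ f i
  concatPerm-small f g {i} i≤m rewrite ⌊⌋-true (i ≤? m) i≤m = refl

  concatPerm-large : ∀ (f g : ℕ → ℕ) {i} → m < i → concatPerm m f g i ≡ g i
  concatPerm-large f g {i} m<i rewrite ⌊⌋-false (i ≤? m) (<⇒≱ m<i) = refl

  complement-basement : ∀ (π₁ π₂ : ℕ → ℕ) i → (i ≤ m → π₁ i ≤ m) → (m < i → m < π₂ i) →
    concatPerm m (compl 1 m π₁) (compl (suc m) n π₂) i ≡ fValue (concatPerm m π₁ π₂ i)
  complement-basement π₁ π₂ i π₁-small π₂-large with i ≤? m
  ... | yes i≤m = begin
    1 + m ∸ π₁ i        ≡⟨ cong (_∸ π₁ i) (+-comm 1 m) ⟩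
    m + 1 ∸ π₁ i        ≡⟨ sym (fValue-small (π₁-small i≤m)) ⟩
    fValue (π₁ i)       ∎
    where open ≡-Reasoning
  ... | no i≰m = begin
    suc m + n ∸ π₂ i    ≡⟨ cong (λ c → c ∸ π₂ i) (trans (cong suc (+-comm m n)) (+-comm 1 (n + m))) ⟩
    n + m + 1 ∸ π₂ i    ≡⟨ sym (fValue-large (π₂-large (≰⇒> i≰m))) ⟩
    fValue (π₂ i)       ∎
    where open ≡-Reasoning

module MajBalance (m n : ℕ) (m≤n : m ≤ n) (π₁ π₂ : ℕ → ℕ)
  (π₁-small : ∀ i → 1 ≤ i → i ≤ m → π₁ i ≤ m) (π₂-large : ∀ i → m < i → i ≤ n → m < π₂ i)
  (μ : ℕ → ℕ) (σ : Filling) (aug : IsAugFilling n μ (concatPerm m π₁ π₂) σ) where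
  open import Data.Nat using (zero; _+_; _*_; _∸_; z≤n; s≤s)
  open import Data.Nat.Properties
  open import Data.Product using (_×_; _,_; proj₁; proj₂)
  open import Relation.Binary.PropositionalEquality
    using (refl; sym; trans; cong; cong₂; subst; module ≡-Reasoning)
  open FiniteSums
  open ComplementMap m n

  τ : Filling
  τ = fMap m n π₁ π₂ σ

  σ∈[1,n] : ∀ {i j} → 1 ≤ i → i ≤ n → j ≤ μ i → 1 ≤ σ i j × σ i j ≤ n
  σ∈[1,n] 1≤i i≤n j≤μi = proj₁ aug _ _ (1≤i , i≤n , j≤μi)

  τ≡fValue∘σ : ∀ {i} → 1 ≤ i → i ≤ n → ∀ j → τ i j ≡ fValue (σ i j)
  τ≡fValue∘σ {i} 1≤i i≤n zero =
    trans (complement-basement π₁ π₂ i (π₁-small i 1≤i) (λ m<i → π₂-large i m<i i≤n))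
      (cong fValue (sym (proj₂ aug i 1≤i i≤n)))
  τ≡fValue∘σ 1≤i i≤n (suc j) = refl

  big-basement-small : ∀ {i} → 1 ≤ i → i ≤ m → big (τ i 0) ≡ 0
  big-basement-small {i} 1≤i i≤m =
    trans (cong big (τ≡fValue∘σ 1≤i i≤n 0))
      (big-fValue-small (proj₁ (σ∈[1,n] 1≤i i≤n z≤n)) σi0≤m)
    where
    i≤n = ≤-trans i≤m m≤n
    σi0≤m : σ i 0 ≤ m
    σi0≤m = subst (_≤ m) (sym (trans (proj₂ aug i 1≤i i≤n) (concatPerm-small π₁ π₂ i≤m)))
      (π₁-small i 1≤i i≤m)

  big-basement-large : ∀ {i} → m < i → i ≤ n → big (τ i 0) ≡ 1
  big-basement-large {i} m<i i≤n =
    trans (cong big (τ≡fValue∘σ 1≤i i≤n 0))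
      (big-fValue-large m<σi0 (proj₂ (σ∈[1,n] 1≤i i≤n z≤n)))
    where
    1≤i = ≤-trans (s≤s z≤n) m<i
    m<σi0 : m < σ i 0
    m<σi0 = subst (m <_) (sym (trans (proj₂ aug i 1≤i i≤n) (concatPerm-large π₁ π₂ m<i)))
      (π₂-large i m<i i≤n)

  basement-weights : sumFrom (λ i → μ i * big (τ i 0)) 1 n ≡ sumRange (suc m) n μ
  basement-weights = begin
    sumFrom h 1 n                              ≡⟨ cong (sumFrom h 1) (sym (m+[n∸m]≡n m≤n)) ⟩
    sumFrom h 1 (m + (n ∸ m))                  ≡⟨ sumFrom-++ h 1 m (n ∸ m) ⟩
    sumFrom h 1 m + sumFrom h (suc m) (n ∸ m)  ≡⟨ cong₂ _+_ small-columns large-columns ⟩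
    0 + sumFrom μ (suc m) (n ∸ m)              ≡⟨ sym (sumRange≡sumFrom (suc m) n μ) ⟩
    sumRange (suc m) n μ                       ∎
    where
    open ≡-Reasoning
    h : ℕ → ℕ
    h i = μ i * big (τ i 0)

    small-columns : sumFrom h 1 m ≡ 0
    small-columns = trans
      (sumFrom-cong 1 m λ i 1≤i i<1+m →
        trans (cong (μ i *_) (big-basement-small 1≤i (≤-pred i<1+m))) (*-zeroʳ (μ i)))
      (sumFrom-0 1 m)

    large-columns : sumFrom h (suc m) (n ∸ m) ≡ sumFrom μ (suc m) (n ∸ m)
    large-columns = sumFrom-cong (suc m) (n ∸ m) λ i m<i i<1+m+[n∸m] →
      trans (cong (μ i *_)
              (big-basement-large m<i (subst (i ≤_) (m+[n∸m]≡n m≤n) (≤-pred i<1+m+[n∸m]))))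
        (*-identityʳ (μ i))

  column-descents : ℕ → ℕ
  column-descents i = sumFrom (descentWeight (μ i) (τ i)) 1 (μ i)

  column-ascents : ℕ → ℕ
  column-ascents i = sumFrom (ascentWeight (μ i) (σ i)) 1 (μ i)

  column-big : ℕ → ℕ
  column-big i = sumFrom (λ j → big (τ i j)) 1 (μ i)

  columns : ∀ i → 1 ≤ i → i < 1 + n →
    column-descents i + μ i * big (τ i 0) ≡ column-ascents i + column-big i
  columns i 1≤i i<1+n = column-balance (μ i) (σ i) (τ i)
    (λ j → σ∈[1,n] 1≤i (≤-pred i<1+n)) (λ j _ → τ≡fValue∘σ 1≤i (≤-pred i<1+n) j)

  balance : maj n μ τ + sumRange (suc m) n μ ≡ maj' n μ σ + countBig m n μ τ
  balance = begin
    maj n μ τ + sumRange (suc m) n μ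
      ≡⟨ cong₂ _+_ (sumRange-nested≡sumFrom n μ λ i → descentWeight (μ i) (τ i))
                   (sym basement-weights) ⟩
    sumFrom column-descents 1 n + sumFrom (λ i → μ i * big (τ i 0)) 1 n
      ≡⟨ sym (sumFrom-+ column-descents _ 1 n) ⟩
    sumFrom (λ i → column-descents i + μ i * big (τ i 0)) 1 n
      ≡⟨ sumFrom-cong 1 n columns ⟩
    sumFrom (λ i → column-ascents i + column-big i) 1 n
      ≡⟨ sumFrom-+ column-ascents column-big 1 n ⟩
    sumFrom column-ascents 1 n + sumFrom column-big 1 n
      ≡⟨ sym (cong₂ _+_ (sumRange-nested≡sumFrom n μ λ i → ascentWeight (μ i) (σ i))
                        (sumRange-nested≡sumFrom n μ λ i j → big (τ i j))) ⟩
    maj' n μ σ + countBig m n μ τ ∎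
    where open ≡-Reasoning

open import Data.Integer using (ℤ; +_; _+_; _-_)
open import Data.Integer.Properties using (pos-+)
open import Data.Integer.Tactic.RingSolver using (solve-∀)
import Data.Nat as ℕ
open import Data.Nat.Properties using (<⇒≤)
open import Data.Product using (proj₁; proj₂)
open import Relation.Binary.PropositionalEquality using (sym; cong; module ≡-Reasoning)

ℕ-balance⇒ℤ : ∀ a b p l → a ℕ.+ p ≡ b ℕ.+ l → + a ≡ (+ b - + p) + + l
ℕ-balance⇒ℤ a b p l a+p≡b+l = begin
  + a                  ≡⟨ add-sub (+ a) (+ p) ⟩
  (+ a + + p) - + p    ≡⟨ cong (_- + p) (sym (pos-+ a p)) ⟩
  + (a ℕ.+ p) - + p    ≡⟨ cong (λ x → + x - + p) a+p≡b+l ⟩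
  + (b ℕ.+ l) - + p    ≡⟨ cong (_- + p) (pos-+ b l) ⟩
  (+ b + + l) - + p    ≡⟨ sub-swap (+ b) (+ l) (+ p) ⟩
  (+ b - + p) + + l    ∎
  where
  open ≡-Reasoning
  add-sub : ∀ (x y : ℤ) → x ≡ (x + y) - y
  add-sub = solve-∀
  sub-swap : ∀ (x y z : ℤ) → (x + y) - z ≡ (x - z) + y
  sub-swap = solve-∀

lemma3p12 : (m n : ℕ) → m < n → (π₁ π₂ : ℕ → ℕ) → IsPermOf 1 m π₁ → IsPermOf (suc m) n π₂ →
    (μ : ℕ → ℕ) → (σ : Filling) → NAF n μ (concatPerm m π₁ π₂) σ →
    + maj n μ (fMap m n π₁ π₂ σ) ≡ (+ maj' n μ σ - + sumRange (suc m) n μ) + + countBig m n μ (fMap m n π₁ π₂ σ)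
lemma3p12 m n m<n π₁ π₂ π₁-perm π₂-perm μ σ naf =
  ℕ-balance⇒ℤ _ _ _ _
    (MajBalance.balance m n (<⇒≤ m<n) π₁ π₂
      (λ i 1≤i i≤m → proj₂ (proj₁ π₁-perm i 1≤i i≤m))
      (λ i m<i i≤n → proj₁ (proj₁ π₂-perm i m<i i≤n))
      μ σ (proj₁ naf))
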